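{- Let $\mathcal{A}=(M,N,A,\pi_c,\pi_d,V_{\min},V_{\max},V_0)$ be a multi-mode system with discrete costs and $t_{\max}>0$. For every finite safe schedule $\sigma$ with time horizon $t_{\max}$ there exists a safe schedule $\sigma'$ with time horizon $t_{\max}$ and $\pi(\sigma')\le\pi(\sigma)$ in which at most one timed action uses a zero-mode, and if such an action exists it is the first timed action of $\sigma'$.
   Context: A multi-mode system with discrete costs is a tuple $\mathcal{A}=(M,N,A,\pi_c,\pi_d,V_{\min},V_{\max},V_0)$ where $M$ is a finite set of modes, $N\ge1$, $A:M\to\mathbb{Q}^N$ gives the constant slope in each mode, $\pi_c:M\to\mathbb{Q}_{\ge0}$ is the cost per time unit in a mode, $\pi_d:M\to\mathbb{Q}_{\ge0}$ is the cost of switching to a mode, $V_{\min}<V_{\max}$ in $\mathbb{Q}^N$, and $V_0$ satisfies $V_{\min}\le V_0\le V_{\max}$. A schedule with time horizon $t_{\max}$ is a finite sequence $\langle(m_1,t_1),\dots,(m_k,t_k)\rangle$ with $m_i\in M$, $t_i>0$, $\sum t_i=t_{\max}$; its run is $\langle V_0,\dots,V_k\rangle$ with $V_{i+1}=V_i+t_{i+1}A(m_{i+1})$; it is safe if $V_{\min}\le V_i\le V_{\max}$ for all $1\le i\le k$; its total cost is $\pi(\sigma)=\sum_i\pi_d(m_i)+\pi_c(m_i)t_i$. A zero-mode is a mode $m$ with $A(m)=0$. -}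

module Defs where

open import Data.Nat using (ℕ; suc)
open import Data.Fin using (Fin)
open import Data.Rational using (ℚ; 0ℚ; _+_; _*_; _≤_; _<_)
open import Data.Product using (_×_; _,_; proj₁; proj₂)
open import Data.List using (List; []; _∷_)
open import Data.Unit using (⊤)
open import Relation.Nullary using (¬_)
open import Data.List.Relation.Unary.All using (All)
open import Relation.Binary.PropositionalEquality using (_≡_)

Vec : ℕ → Set
Vec N = Fin N → ℚ

_≤ᵛ_ : {N : ℕ} → Vec N → Vec N → Set
u ≤ᵛ v = ∀ i → u i ≤ v i

_<ᵛ_ : {N : ℕ} → Vec N → Vec N → Set
u <ᵛ v = ∀ i → u i < v i

_+ᵛ_ : {N : ℕ} → Vec N → Vec N → Vec N
(u +ᵛ v) i = u i + v i

_·ᵛ_ : {N : ℕ} → ℚ → Vec N → Vec N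
(t ·ᵛ v) i = t * v i

record MMS : Set where
  field
    k      : ℕ
    n      : ℕ                     -- dimension N = suc n ≥ 1
    A      : Fin k → Vec (suc n)
    πc     : Fin k → ℚ
    πd     : Fin k → ℚ
    πc≥0   : ∀ m → 0ℚ ≤ πc m
    πd≥0   : ∀ m → 0ℚ ≤ πd m
    Vmin   : Vec (suc n)
    Vmax   : Vec (suc n)
    V0     : Vec (suc n)
    Vmin<Vmax : Vmin <ᵛ Vmax
    Vmin≤V0   : Vmin ≤ᵛ V0
    V0≤Vmax   : V0 ≤ᵛ Vmax

module _ (𝒜 : MMS) where
  open MMS 𝒜

  Schedule : Set
  Schedule = List (Fin k × ℚ)

  duration : Schedule → ℚ
  duration [] = 0ℚ
  duration ((m , t) ∷ σ) = t + duration σ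

  HasHorizon : ℚ → Schedule → Set
  HasHorizon tmax σ = All (λ a → 0ℚ < proj₂ a) σ × (duration σ ≡ tmax)

  -- The run V₁,…,V_k starting after V (V itself, i.e. V₀, excluded).
  runFrom : Vec (suc n) → Schedule → List (Vec (suc n))
  runFrom V [] = []
  runFrom V ((m , t) ∷ σ) = let V' = V +ᵛ (t ·ᵛ A m) in V' ∷ runFrom V' σ

  Safe : Schedule → Set
  Safe σ = All (λ V → Vmin ≤ᵛ V × V ≤ᵛ Vmax) (runFrom V0 σ)

  cost : Schedule → ℚ
  cost [] = 0ℚ
  cost ((m , t) ∷ σ) = (πd m + πc m * t) + cost σ

  ZeroMode : Fin k → Set
  ZeroMode m = ∀ i → A m i ≡ 0ℚ

  -- At most one timed action uses a zero-mode, and if one does, it is the first: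
  -- i.e. no action after the first uses a zero-mode.
  ZeroModeOnlyFirst : Schedule → Set
  ZeroModeOnlyFirst [] = ⊤
  ZeroModeOnlyFirst (a ∷ σ) = All (λ b → ¬ ZeroMode (proj₁ b)) σ

-- A zero-mode action does not move the state, so it can be moved to the front of a
-- schedule without changing the run beyond repeating V₀ (which is safe), its duration
-- or its cost; two adjacent zero-mode actions merge into one action of the mode with
-- the smaller rate, which saves a discrete cost and cannot raise the continuous one.
-- Normalising the schedule from the back with these two moves leaves at most one
-- zero-mode action, at the front.
module Submission where

open import Defs
open import Data.Rational using (ℚ; 0ℚ; _≤_; _<_)
open import Data.Product using (Σ; _×_)

open import Algebra.Bundles using (CommutativeMonoid)
open import Data.Fin using (Fin)
open import Data.Fin.Properties using (all?)
open import Data.List using ([]; _∷_)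
open import Data.List.Relation.Unary.All using (All; []; _∷_)
open import Data.Nat using (suc)
open import Data.Product using (_,_; proj₂)
open import Data.Rational using (_+_; _*_; nonNegative)
import Data.Rational.Properties as ℚ
open import Data.Sum using (inj₁; inj₂)
open import Data.Unit using (tt)
open import Relation.Nullary using (Dec; yes; no)
open import Relation.Binary.PropositionalEquality using (_≡_; refl; sym; trans; cong; subst)

open import Algebra.Properties.CommutativeSemigroup
  (CommutativeMonoid.commutativeSemigroup ℚ.+-0-commutativeMonoid)
  using (x∙yz≈y∙xz)

0≤p⇒q≤p+q : ∀ {p} q → 0ℚ ≤ p → q ≤ p + q
0≤p⇒q≤p+q {p} q 0≤p = subst (_≤ p + q) (ℚ.+-identityˡ q) (ℚ.+-monoˡ-≤ q 0≤p)

0<p⇒0<q⇒0<p+q : ∀ {p q} → 0ℚ < p → 0ℚ < q → 0ℚ < p + q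
0<p⇒0<q⇒0<p+q {p} {q} 0<p 0<q = subst (_< p + q) (ℚ.+-identityʳ 0ℚ) (ℚ.+-mono-< 0<p 0<q)

merged-cost≤ : ∀ d c t d′ c′ s r → c ≤ c′ → 0ℚ ≤ d′ → 0ℚ ≤ s →
  (d + c * (t + s)) + r ≤ (d + c * t) + ((d′ + c′ * s) + r)
merged-cost≤ d c t d′ c′ s r c≤c′ 0≤d′ 0≤s = begin
  (d + c * (t + s)) + r         ≡⟨ cong (λ x → (d + x) + r) (ℚ.*-distribˡ-+ c t s) ⟩
  (d + (c * t + c * s)) + r     ≡⟨ cong (_+ r) (sym (ℚ.+-assoc d (c * t) (c * s))) ⟩
  ((d + c * t) + c * s) + r     ≡⟨ ℚ.+-assoc (d + c * t) (c * s) r ⟩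
  (d + c * t) + (c * s + r)     ≤⟨ ℚ.+-monoʳ-≤ (d + c * t) (ℚ.+-monoˡ-≤ r c*s≤d′+c′*s) ⟩
  (d + c * t) + ((d′ + c′ * s) + r) ∎
  where
  open ℚ.≤-Reasoning
  c*s≤d′+c′*s : c * s ≤ d′ + c′ * s
  c*s≤d′+c′*s = ℚ.≤-trans (ℚ.*-monoʳ-≤-nonNeg s {{nonNegative 0≤s}} c≤c′)
                          (0≤p⇒q≤p+q (c′ * s) 0≤d′)

module _ (𝒜 : MMS) where
  open MMS 𝒜

  State : Set
  State = Vec (suc n)

  _≐_ : State → State → Set
  U ≐ V = ∀ i → U i ≡ V i

  ≐-sym : ∀ {U V} → U ≐ V → V ≐ U
  ≐-sym U≐V i = sym (U≐V i)

  ≐-trans : ∀ {U V W} → U ≐ V → V ≐ W → U ≐ W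
  ≐-trans U≐V V≐W i = trans (U≐V i) (V≐W i)

  step : State → Fin k → ℚ → State
  step V m t = V +ᵛ (t ·ᵛ A m)

  step-cong : ∀ {U V} → U ≐ V → ∀ m t → step U m t ≐ step V m t
  step-cong U≐V m t i = cong (_+ t * A m i) (U≐V i)

  step-zeroMode : ∀ V {m} t → ZeroMode 𝒜 m → step V m t ≐ V
  step-zeroMode V {m} t zero-m i rewrite zero-m i | ℚ.*-zeroʳ t = ℚ.+-identityʳ (V i)

  zeroMode? : (m : Fin k) → Dec (ZeroMode 𝒜 m)
  zeroMode? m = all? (λ i → A m i ℚ.≟ 0ℚ)

  InBounds : State → Set
  InBounds V = Vmin ≤ᵛ V × V ≤ᵛ Vmax

  InBounds-cong : ∀ {U V} → U ≐ V → InBounds U → InBounds V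
  InBounds-cong U≐V (lo , hi) =
    (λ i → subst (Vmin i ≤_) (U≐V i) (lo i)) , (λ i → subst (_≤ Vmax i) (U≐V i) (hi i))

  SafeFrom : State → Schedule 𝒜 → Set
  SafeFrom V σ = All InBounds (runFrom 𝒜 V σ)

  SafeFrom-cong : ∀ {U V} → U ≐ V → ∀ σ → SafeFrom U σ → SafeFrom V σ
  SafeFrom-cong U≐V []            []           = []
  SafeFrom-cong U≐V ((m , t) ∷ σ) (safe ∷ rest) =
    InBounds-cong U≐V′ safe ∷ SafeFrom-cong U≐V′ σ rest
    where U≐V′ = step-cong U≐V m t

  Positive : Schedule 𝒜 → Set
  Positive = All (λ a → 0ℚ < proj₂ a)

  record _⊑[_]_ (σ′ : Schedule 𝒜) (V : State) (σ : Schedule 𝒜) : Set where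
    field
      positive  : Positive σ′
      safeFrom  : SafeFrom V σ′
      duration≡ : duration 𝒜 σ′ ≡ duration 𝒜 σ
      cost≤     : cost 𝒜 σ′ ≤ cost 𝒜 σ
  open _⊑[_]_

  ⊑-refl : ∀ {V σ} → Positive σ → SafeFrom V σ → σ ⊑[ V ] σ
  ⊑-refl pos safe = record
    { positive = pos ; safeFrom = safe ; duration≡ = refl ; cost≤ = ℚ.≤-refl }

  ⊑-trans : ∀ {V σ″ σ′ σ} → σ″ ⊑[ V ] σ′ → σ′ ⊑[ V ] σ → σ″ ⊑[ V ] σ
  ⊑-trans σ″⊑σ′ σ′⊑σ = record
    { positive  = positive σ″⊑σ′
    ; safeFrom  = safeFrom σ″⊑σ′
    ; duration≡ = trans (duration≡ σ″⊑σ′) (duration≡ σ′⊑σ)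
    ; cost≤     = ℚ.≤-trans (cost≤ σ″⊑σ′) (cost≤ σ′⊑σ)
    }

  ∷-mono-⊑ : ∀ {V m t σ′ σ} → 0ℚ < t → InBounds (step V m t) →
    σ′ ⊑[ step V m t ] σ → ((m , t) ∷ σ′) ⊑[ V ] ((m , t) ∷ σ)
  ∷-mono-⊑ {m = m} {t} 0<t inBounds σ′⊑σ = record
    { positive  = 0<t ∷ positive σ′⊑σ
    ; safeFrom  = inBounds ∷ safeFrom σ′⊑σ
    ; duration≡ = cong (t +_) (duration≡ σ′⊑σ)
    ; cost≤     = ℚ.+-monoʳ-≤ (πd m + πc m * t) (cost≤ σ′⊑σ)
    }

  zeroMode-first-⊑ : ∀ {V m t z T ρ} → ZeroMode 𝒜 z → InBounds V →
    Positive ((m , t) ∷ (z , T) ∷ ρ) → SafeFrom V ((m , t) ∷ (z , T) ∷ ρ) →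
    ((z , T) ∷ (m , t) ∷ ρ) ⊑[ V ] ((m , t) ∷ (z , T) ∷ ρ)
  zeroMode-first-⊑ {V} {m} {t} {z} {T} {ρ} zero-z inBounds (0<t ∷ 0<T ∷ pos) (safe₁ ∷ _ ∷ safe) =
    record
    { positive  = 0<T ∷ 0<t ∷ pos
    ; safeFrom  = InBounds-cong (≐-sym V≐V₁) inBounds
                ∷ InBounds-cong (≐-sym V₁≐V₂) safe₁
                ∷ SafeFrom-cong (≐-trans (step-zeroMode _ T zero-z) (≐-sym V₁≐V₂)) ρ safe
    ; duration≡ = x∙yz≈y∙xz T t (duration 𝒜 ρ)
    ; cost≤     = ℚ.≤-reflexive (x∙yz≈y∙xz (πd z + πc z * T) (πd m + πc m * t) (cost 𝒜 ρ))
    }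
    where
    V≐V₁ = step-zeroMode V T zero-z
    V₁≐V₂ = step-cong V≐V₁ m t

  zeroModes-merge-⊑ : ∀ {V m t z T ρ} → ZeroMode 𝒜 m → ZeroMode 𝒜 z → πc m ≤ πc z →
    InBounds V → Positive ((m , t) ∷ (z , T) ∷ ρ) → SafeFrom V ((m , t) ∷ (z , T) ∷ ρ) →
    ((m , t + T) ∷ ρ) ⊑[ V ] ((m , t) ∷ (z , T) ∷ ρ)
  zeroModes-merge-⊑ {V} {m} {t} {z} {T} {ρ} zero-m zero-z πc-m≤πc-z inBounds
    (0<t ∷ 0<T ∷ pos) (_ ∷ _ ∷ safe) = record
    { positive  = 0<p⇒0<q⇒0<p+q 0<t 0<T ∷ pos
    ; safeFrom  = InBounds-cong (≐-sym V≐V′) inBounds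
                ∷ SafeFrom-cong V₂≐V′ ρ safe
    ; duration≡ = ℚ.+-assoc t T (duration 𝒜 ρ)
    ; cost≤     = merged-cost≤ (πd m) (πc m) t (πd z) (πc z) T (cost 𝒜 ρ)
                    πc-m≤πc-z (πd≥0 z) (ℚ.<⇒≤ 0<T)
    }
    where
    V≐V′ = step-zeroMode V (t + T) zero-m
    V₂≐V′ = ≐-trans (step-zeroMode _ T zero-z)
              (≐-trans (step-zeroMode V t zero-m) (≐-sym V≐V′))

  Normalises : State → Schedule 𝒜 → Set
  Normalises V σ = Σ (Schedule 𝒜) λ σ′ → σ′ ⊑[ V ] σ × ZeroModeOnlyFirst 𝒜 σ′

  normalise-∷ : ∀ {V m t ρ} → InBounds V → Positive ((m , t) ∷ ρ) →
    SafeFrom V ((m , t) ∷ ρ) → ZeroModeOnlyFirst 𝒜 ρ → Normalises V ((m , t) ∷ ρ)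
  normalise-∷ {ρ = []} _ pos safe _ = _ , ⊑-refl pos safe , []
  normalise-∷ {m = m} {ρ = (z , T) ∷ ρ} inBounds pos safe onlyFirst
    with zeroMode? m | zeroMode? z
  ... | _ | no nonzero-z = _ , ⊑-refl pos safe , nonzero-z ∷ onlyFirst
  ... | no nonzero-m | yes zero-z =
    _ , zeroMode-first-⊑ zero-z inBounds pos safe , nonzero-m ∷ onlyFirst
  ... | yes zero-m | yes zero-z with ℚ.≤-total (πc m) (πc z)
  ...   | inj₁ πc-m≤πc-z =
    _ , zeroModes-merge-⊑ zero-m zero-z πc-m≤πc-z inBounds pos safe , onlyFirst
  ...   | inj₂ πc-z≤πc-m =
    _ , ⊑-trans (zeroModes-merge-⊑ zero-z zero-m πc-z≤πc-m inBounds
                   (positive swapped) (safeFrom swapped))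
                swapped
      , onlyFirst
    where swapped = zeroMode-first-⊑ zero-z inBounds pos safe

  normalise : ∀ {V} σ → InBounds V → Positive σ → SafeFrom V σ → Normalises V σ
  normalise [] _ pos safe = [] , ⊑-refl pos safe , tt
  normalise ((m , t) ∷ ρ) inBounds (0<t ∷ pos) (inBounds₁ ∷ safe)
    with normalise ρ inBounds₁ pos safe
  ... | ρ′ , ρ′⊑ρ , onlyFirst
    with normalise-∷ inBounds (0<t ∷ positive ρ′⊑ρ) (inBounds₁ ∷ safeFrom ρ′⊑ρ) onlyFirst
  ...   | σ′ , σ′⊑ , onlyFirst′ = σ′ , ⊑-trans σ′⊑ (∷-mono-⊑ 0<t inBounds₁ ρ′⊑ρ) , onlyFirst′

proposition3 : (𝒜 : MMS) → (tmax : ℚ) → 0ℚ < tmax →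
    (σ : Schedule 𝒜) → HasHorizon 𝒜 tmax σ → Safe 𝒜 σ →
    Σ (Schedule 𝒜) λ σ' → HasHorizon 𝒜 tmax σ' × Safe 𝒜 σ' ×
    (cost 𝒜 σ' ≤ cost 𝒜 σ) × ZeroModeOnlyFirst 𝒜 σ'
proposition3 𝒜 tmax _ σ (pos , duration≡tmax) safe
  with normalise 𝒜 σ (MMS.Vmin≤V0 𝒜 , MMS.V0≤Vmax 𝒜) pos safe
... | σ′ , σ′⊑σ , onlyFirst =
  σ′ , (positive σ′⊑σ , trans (duration≡ σ′⊑σ) duration≡tmax) , safeFrom σ′⊑σ , cost≤ σ′⊑σ , onlyFirst
  where open _⊑[_]_
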